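{- Let $\mathcal{H}\in Forb(n,T_5,\eta,\mu)$ and let $(X,Y)$ be an optimal ordered partition of $\mathcal{H}$. Then: (i) for every $x\in X$, $|L_{X,X}(x)|\le 2\mu n^2$; (ii) for every $y\in Y$, $|L_{X,Y}(y)|\le 2\mu n^2$; (iii) for every $y\in Y$, $\min\{|L_{X,X}(y)|,|L_{Y,Y}(y)|\}<2\mu n^2$.
   Context: A 3-graph on $[n]$ is a set of 3-subsets of $[n]$; $T_5=\{123,124,125,345\}$. Standing assumption: $\mu,\eta$ are small positive constants with $\mu\gg\eta$, in particular $\mu^3\ge1000H(\eta)$ where $H$ is the binary entropy function. For an ordered partition $(X,Y)$ of the vertex set, an edge is consistent if it has exactly two vertices in $X$, inconsistent otherwise; a partition is optimal if it minimizes the number of inconsistent edges, and $D_{\mathcal{H}}$ is that minimum. $Forb(n,T_5,\eta)$ is the set of $T_5$-free 3-graphs on $[n]$ with $D_{\mathcal{H}}\le\eta n^3$. An ordered partition $(X,Y)$ of $\mathcal{H}$ is $\mu$-lower-dense if: (i) for every matching $G_1\subset\binom{X}{2}$ and every graph $G_2\subset X\times Y$ with $|G_1|>\mu n$, $|G_2|>\mu n^2$, the number of pairs $(ab,uv)$ with $ab\in G_2$, $uv\in G_1$, $abu,abv\in\mathcal{H}$ exceeds $|G_1||G_2|/72$; (ii) for every graph $G_1\subset\binom{X}{2}$ and every matching $G_2\subset\binom{Y}{2}$ with $|G_1|>\mu n^2$, $|G_2|>\mu n$, the number of pairs $(ab,uv)$ with $ab\in G_2$, $uv\in G_1$, $auv,buv\in\mathcal{H}$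 exceeds $|G_1||G_2|/8$; (iii) for every $A_X\subset X$, $A_Y\subset Y$ with $|A_X|,|A_Y|\ge\mu n$, the number of edges $E$ with $|E\cap A_X|=2$, $|E\cap A_Y|=1$ exceeds $|A_X|^2|A_Y|/8$; (iv) for every $Y'\subset Y$ with $|Y'|\ge 2\mu n$ and sets $X_y\subset X$ ($y\in Y'$) with $|X_y|>200\mu n$, the number of edges $E$ for which some $y\in Y'$ has $y\in E$ and $|E\cap X_y|=2$ exceeds $10000\mu^3n^3$; (v) $||Y|-n/3|<\mu n$. $Forb(n,T_5,\eta,\mu)$ is the set of $\mathcal{H}\in Forb(n,T_5,\eta)$ all of whose optimal partitions are $\mu$-lower-dense. For a vertex $v$ and $A,B\in\{X,Y\}$, $L_{A,B}(v)$ is the set of edges of $\mathcal{H}$ containing $v$ whose other two vertices lie one in $A$ and one in $B$ (both in $A$ if $A=B$).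
   Formalization: The constants μ and η range over the positive rationals. -}

module Defs where

open import Data.Nat as ℕ using (ℕ; zero; suc; _≡ᵇ_)
open import Data.Bool using (Bool; true; false; _∧_; _∨_; not; if_then_else_)
open import Data.Fin using (Fin)
open import Data.List using (List; []; _∷_; _++_; map; filter; length; foldr; allFin; cartesianProduct)
open import Data.Bool.ListAction using (all; any)
open import Data.Vec using (Vec; []; _∷_)
open import Data.Fin.Subset using (Subset; ⁅_⁆; _∪_; _∩_; ∁; ∣_∣; _⊆_; _∈_)
open import Data.Fin.Subset using () renaming (_-_ to _∖_)
open import Data.Fin.Subset.Properties using (_∈?_; _⊆?_)
open import Data.Product using (_×_; _,_; proj₁; proj₂)
open import Data.Integer using (+_)
open import Data.Rational using (ℚ; _/_; _*_; _-_; _<_; _≤_; _>_; _≥_)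
  renaming (∣_∣ to absℚ)
open import Data.Empty using (⊥)
open import Relation.Nullary.Decidable using (⌊_⌋)
open import Relation.Binary.PropositionalEquality using (_≡_; _≢_)

allSubsets : (n : ℕ) → List (Subset n)
allSubsets zero    = [] ∷ []
allSubsets (suc n) = map (true ∷_) (allSubsets n) ++ map (false ∷_) (allSubsets n)

count : {A : Set} → (A → Bool) → List A → ℕ
count p []       = 0
count p (x ∷ xs) = if p x then suc (count p xs) else count p xs

#sub : {n : ℕ} → (Subset n → Bool) → ℕ
#sub {n} p = count p (allSubsets n)

_=ᵇ_ : ℕ → ℕ → Bool
_=ᵇ_ = _≡ᵇ_

ℕ→ℚ : ℕ → ℚ
ℕ→ℚ k = (+ k) / 1

-- A 3-graph on Fin n: the edges are the 3-subsets S with H S ≡ true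
-- (the value of H on subsets of other sizes is irrelevant).
3Graph : ℕ → Set
3Graph n = Subset n → Bool

isEdge : {n : ℕ} → 3Graph n → Subset n → Bool
isEdge H S = (∣ S ∣ =ᵇ 3) ∧ H S

Edge : {n : ℕ} → 3Graph n → Subset n → Set
Edge H S = isEdge H S ≡ true

#edges : {n : ℕ} → 3Graph n → (Subset n → Bool) → ℕ
#edges H p = #sub (λ S → isEdge H S ∧ p S)

⟪_,_,_⟫ : {n : ℕ} → Fin n → Fin n → Fin n → Subset n
⟪ a , b , c ⟫ = ⁅ a ⁆ ∪ (⁅ b ⁆ ∪ ⁅ c ⁆)

-- T5 = {123,124,125,345}.  H is T5-free iff there are no five distinct
-- vertices v1..v5 with v1v2v3, v1v2v4, v1v2v5, v3v4v5 all edges of H.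
T5-free : {n : ℕ} → 3Graph n → Set
T5-free {n} H = (v1 v2 v3 v4 v5 : Fin n) →
  v1 ≢ v2 → v1 ≢ v3 → v1 ≢ v4 → v1 ≢ v5 → v2 ≢ v3 → v2 ≢ v4 → v2 ≢ v5 →
  v3 ≢ v4 → v3 ≢ v5 → v4 ≢ v5 →
  Edge H ⟪ v1 , v2 , v3 ⟫ → Edge H ⟪ v1 , v2 , v4 ⟫ → Edge H ⟪ v1 , v2 , v5 ⟫ →
  Edge H ⟪ v3 , v4 , v5 ⟫ → ⊥

Graph : ℕ → Set
Graph n = Subset n → Bool

isGEdge : {n : ℕ} → Graph n → Subset n → Bool
isGEdge G S = (∣ S ∣ =ᵇ 2) ∧ G S

#G : {n : ℕ} → Graph n → ℕ
#G G = #sub (isGEdge G)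

GraphIn : {n : ℕ} → Graph n → Subset n → Set
GraphIn G A = ∀ S → isGEdge G S ≡ true → S ⊆ A

GraphBetween : {n : ℕ} → Graph n → Subset n → Subset n → Set
GraphBetween G X Y = ∀ S → isGEdge G S ≡ true → (∣ S ∩ X ∣ ≡ 1) × (∣ S ∩ Y ∣ ≡ 1)

Matching : {n : ℕ} → Graph n → Set
Matching G = ∀ S T → isGEdge G S ≡ true → isGEdge G T ≡ true → S ≢ T → ∣ S ∩ T ∣ ≡ 0

-- An ordered partition (X, Y) of Fin n is given by X; Y = ∁ X.
-- An edge is consistent iff it has exactly two vertices in X.
inconsistent : {n : ℕ} → Subset n → Subset n → Bool
inconsistent X E = not (∣ E ∩ X ∣ =ᵇ 2)

#inc : {n : ℕ} → 3Graph n → Subset n → ℕ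
#inc H X = #edges H (inconsistent X)

Optimal : {n : ℕ} → 3Graph n → Subset n → Set
Optimal {n} H X = ∀ (X' : Subset n) → #inc H X ℕ.≤ #inc H X'

D : {n : ℕ} → 3Graph n → ℕ
D {n} H = foldr (λ X m → #inc H X ℕ.⊓ m) (#inc H (Data.Vec.replicate n false)) (allSubsets n)

Forb : (n : ℕ) → ℚ → 3Graph n → Set
Forb n η H = T5-free H × (ℕ→ℚ (D H) ≤ η * ℕ→ℚ (n ℕ.^ 3))

#pairsI : {n : ℕ} → 3Graph n → Graph n → Graph n → ℕ
#pairsI {n} H G1 G2 =
  count (λ p → isGEdge G2 (proj₁ p) ∧ isGEdge G1 (proj₂ p) ∧
               all (λ u → if ⌊ u ∈? proj₂ p ⌋ then isEdge H (proj₁ p ∪ ⁅ u ⁆) else true)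
                   (allFin n))
        (cartesianProduct (allSubsets n) (allSubsets n))

#pairsII : {n : ℕ} → 3Graph n → Graph n → Graph n → ℕ
#pairsII {n} H G1 G2 =
  count (λ p → isGEdge G2 (proj₁ p) ∧ isGEdge G1 (proj₂ p) ∧
               all (λ a → if ⌊ a ∈? proj₁ p ⌋ then isEdge H (⁅ a ⁆ ∪ proj₂ p) else true)
                   (allFin n))
        (cartesianProduct (allSubsets n) (allSubsets n))

LowerDense : {n : ℕ} → ℚ → 3Graph n → Subset n → Set
LowerDense {n} μ H X =
  ((G1 G2 : Graph n) → GraphIn G1 X → Matching G1 → GraphBetween G2 X Y →
     ℕ→ℚ (#G G1) > μ * nq → ℕ→ℚ (#G G2) > μ * (nq * nq) →
     72 ℕ.* #pairsI H G1 G2 ℕ.> #G G1 ℕ.* #G G2)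
  ×
  ((G1 G2 : Graph n) → GraphIn G1 X → GraphIn G2 Y → Matching G2 →
     ℕ→ℚ (#G G1) > μ * (nq * nq) → ℕ→ℚ (#G G2) > μ * nq →
     8 ℕ.* #pairsII H G1 G2 ℕ.> #G G1 ℕ.* #G G2)
  ×
  ((AX AY : Subset n) → AX ⊆ X → AY ⊆ Y →
     ℕ→ℚ ∣ AX ∣ ≥ μ * nq → ℕ→ℚ ∣ AY ∣ ≥ μ * nq →
     8 ℕ.* #edges H (λ E → (∣ E ∩ AX ∣ =ᵇ 2) ∧ (∣ E ∩ AY ∣ =ᵇ 1))
       ℕ.> ∣ AX ∣ ℕ.* ∣ AX ∣ ℕ.* ∣ AY ∣)
  ×
  ((Y' : Subset n) (Xs : Fin n → Subset n) → Y' ⊆ Y →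
     ℕ→ℚ ∣ Y' ∣ ≥ ℕ→ℚ 2 * μ * nq →
     (∀ y → y ∈ Y' → Xs y ⊆ X × ℕ→ℚ ∣ Xs y ∣ > ℕ→ℚ 200 * μ * nq) →
     ℕ→ℚ (#edges H (λ E → any (λ y → ⌊ y ∈? Y' ⌋ ∧ ⌊ y ∈? E ⌋ ∧ (∣ E ∩ Xs y ∣ =ᵇ 2))
                               (allFin n)))
       > ℕ→ℚ 10000 * (μ * μ * μ) * (nq * nq * nq))
  ×
  (absℚ (ℕ→ℚ ∣ Y ∣ - (+ n) / 3) < μ * nq)
  where
    Y = ∁ X
    nq = ℕ→ℚ n

ForbLD : (n : ℕ) → ℚ → ℚ → 3Graph n → Set
ForbLD n η μ H = Forb n η H × (∀ X → Optimal H X → LowerDense μ H X)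

#Lsame : {n : ℕ} → 3Graph n → Subset n → Fin n → ℕ
#Lsame H A v = #edges H (λ E → ⌊ v ∈? E ⌋ ∧ (∣ (E ∖ v) ∩ A ∣ =ᵇ 2))

#Lcross : {n : ℕ} → 3Graph n → Subset n → Subset n → Fin n → ℕ
#Lcross H A B v = #edges H (λ E → ⌊ v ∈? E ⌋ ∧ (∣ (E ∖ v) ∩ A ∣ =ᵇ 1) ∧ (∣ (E ∖ v) ∩ B ∣ =ᵇ 1))

{-# OPTIONS --safe #-}
module Submission where

-- Moving a vertex across an optimal partition cannot lower the number of inconsistent edges:
-- for x ∈ X this gives |L_XX(x)| ≤ |L_XY(x)|, and for y ∈ Y it gives |L_XY(y)| ≤ |L_XX(y)|.
-- So it suffices that no vertex v has two heavy links (of size ≥ 2μn²) of the kinds XX and XY,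
-- or XX and YY. A greedy matching in a heavy link has more than μn edges, since each of its
-- edges meets at most 2(n − 1) pairs, and a heavy link has more than μn² edges. Lower density,
-- part (i) resp. (ii), then yields an edge uw of a greedy matching in one link of v and an edge
-- ab of the other link with abu, abw ∈ H; together with abv, uwv ∈ H this is a copy of T5.
-- Only T5-freeness, optimality and parts (i) and (ii) of lower density are used.

open import Defs
open import Data.Bool using (Bool; true; false; _∧_; _∨_; not; if_then_else_; T)
open import Data.Product using (∃; ∃₂; _×_; _,_; proj₁; proj₂)
open import Data.Sum using (_⊎_; inj₁; inj₂)
open import Data.Empty using (⊥-elim) renaming (⊥ to Empty)
open import Relation.Binary.PropositionalEquality

module BooleanCounting where

  open import Data.Nat using (ℕ; suc; _+_; _≤_; _<_; z≤n; s≤s)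
  open import Data.Nat.Properties
    using (≡ᵇ⇒≡; ≡⇒≡ᵇ; ≤-trans; ≤-reflexive; m≤n⇒m≤1+n; n≤1+n; +-suc; +-mono-≤; +-monoʳ-≤)
  open import Data.List using (List; []; _∷_; _++_; map)
  open import Data.List.Membership.Propositional using (_∈_)
  open import Data.List.Relation.Unary.Any using (here; there)
  open import Relation.Nullary using (Dec; yes; ¬_)
  open import Data.Bool.Properties using (T-≡)
  open import Function.Bundles using (Equivalence)
  open import Relation.Nullary.Decidable using (⌊_⌋; isYes≗does; dec-true; dec-false)

  private variable
    A B : Set
    p q r s : A → Bool

  𝟙 : Bool → ℕ
  𝟙 b = if b then 1 else 0

  ∧-true⁻ : ∀ {a b} → a ∧ b ≡ true → a ≡ true × b ≡ true
  ∧-true⁻ {true} {true} _ = refl , refl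

  not-both : ∀ {b} → b ≡ true → not b ≡ true → Empty
  not-both refl ()

  ≡true⇒T : ∀ {b} → b ≡ true → T b
  ≡true⇒T = Equivalence.from T-≡

  T⇒≡true : ∀ {b} → T b → b ≡ true
  T⇒≡true = Equivalence.to T-≡

  =ᵇ⇒≡ : ∀ {m n} → (m =ᵇ n) ≡ true → m ≡ n
  =ᵇ⇒≡ {m} {n} h = ≡ᵇ⇒≡ m n (≡true⇒T h)

  ≡⇒=ᵇ : ∀ {m n} → m ≡ n → (m =ᵇ n) ≡ true
  ≡⇒=ᵇ {m} {n} h with m =ᵇ n | ≡⇒≡ᵇ m n h
  ... | true | _ = refl

  ⌊⌋-true : ∀ {P : Set} (d : Dec P) → P → ⌊ d ⌋ ≡ true
  ⌊⌋-true d p = trans (isYes≗does d) (dec-true d p)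

  ⌊⌋-false : ∀ {P : Set} (d : Dec P) → ¬ P → ⌊ d ⌋ ≡ false
  ⌊⌋-false d ¬p = trans (isYes≗does d) (dec-false d ¬p)

  ⌊⌋⇒ : ∀ {P : Set} (d : Dec P) → ⌊ d ⌋ ≡ true → P
  ⌊⌋⇒ (yes p) _ = p

  count-++ : ∀ (p : A → Bool) xs ys → count p (xs ++ ys) ≡ count p xs + count p ys
  count-++ p []       ys = refl
  count-++ p (x ∷ xs) ys with p x
  ... | true  = cong suc (count-++ p xs ys)
  ... | false = count-++ p xs ys

  count-map : ∀ (p : B → Bool) (f : A → B) xs → count p (map f xs) ≡ count (λ x → p (f x)) xs
  count-map p f []       = refl
  count-map p f (x ∷ xs) with p (f x)
  ... | true  = cong suc (count-map p f xs)
  ... | false = count-map p f xs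

  count-cong : (∀ x → p x ≡ q x) → ∀ xs → count p xs ≡ count q xs
  count-cong p≗q []       = refl
  count-cong p≗q (x ∷ xs) rewrite p≗q x | count-cong p≗q xs = refl

  count-false : ∀ (xs : List A) → count (λ _ → false) xs ≡ 0
  count-false []       = refl
  count-false (x ∷ xs) = count-false xs

  count-none : (∀ x → p x ≡ true → Empty) → ∀ xs → count p xs ≡ 0
  count-none never []       = refl
  count-none {p = p} never (x ∷ xs) with p x in px
  ... | true  = ⊥-elim (never x px)
  ... | false = count-none never xs

  count-mono : (∀ x → p x ≡ true → q x ≡ true) → ∀ xs → count p xs ≤ count q xs
  count-mono p⇒q [] = z≤n
  count-mono {p = p} {q = q} p⇒q (x ∷ xs) with p x in px | q x in qx
  ... | true  | true  = s≤s (count-mono p⇒q xs)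
  ... | true  | false with () ← trans (sym (p⇒q x px)) qx
  ... | false | true  = m≤n⇒m≤1+n (count-mono p⇒q xs)
  ... | false | false = count-mono p⇒q xs

  count-mono-< : (∀ x → p x ≡ true → q x ≡ true) → ∀ {y} xs → y ∈ xs → p y ≡ false → q y ≡ true →
                 count p xs < count q xs
  count-mono-< p⇒q (x ∷ xs) (here refl) py qy rewrite py | qy = s≤s (count-mono p⇒q xs)
  count-mono-< {p = p} {q = q} p⇒q (x ∷ xs) (there y∈xs) py qy with p x in px | q x in qx
  ... | true  | true  = s≤s (count-mono-< p⇒q xs y∈xs py qy)
  ... | true  | false with () ← trans (sym (p⇒q x px)) qx
  ... | false | true  = m≤n⇒m≤1+n (count-mono-< p⇒q xs y∈xs py qy)
  ... | false | false = count-mono-< p⇒q xs y∈xs py qy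

  count-witness : ∀ (p : A → Bool) xs → 0 < count p xs → ∃ λ x → p x ≡ true
  count-witness p (x ∷ xs) 0<count with p x in px
  ... | true  = x , px
  ... | false = count-witness p xs 0<count

  count-∨ : ∀ (p q : A → Bool) xs → count (λ x → p x ∨ q x) xs ≤ count p xs + count q xs
  count-∨ p q []       = z≤n
  count-∨ p q (x ∷ xs) with p x | q x
  ... | true  | true  = s≤s (≤-trans (count-∨ p q xs) (+-monoʳ-≤ (count p xs) (n≤1+n _)))
  ... | true  | false = s≤s (count-∨ p q xs)
  ... | false | true  = ≤-trans (s≤s (count-∨ p q xs)) (≤-reflexive (sym (+-suc _ _)))
  ... | false | false = count-∨ p q xs

  count-+-mono : (∀ x → 𝟙 (r x) + 𝟙 (s x) ≤ 𝟙 (p x) + 𝟙 (q x)) →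
                 ∀ xs → count r xs + count s xs ≤ count p xs + count q xs
  count-+-mono pointwise [] = z≤n
  count-+-mono {r = r} {s = s} {p = p} {q = q} pointwise (x ∷ xs) =
    ≤-trans (≤-reflexive (split (r x) (s x) (count r xs) (count s xs)))
      (≤-trans (+-mono-≤ (pointwise x) (count-+-mono pointwise xs))
        (≤-reflexive (sym (split (p x) (q x) (count p xs) (count q xs)))))
    where
    split : ∀ a b m n → (if a then suc m else m) + (if b then suc n else n) ≡ (𝟙 a + 𝟙 b) + (m + n)
    split false false m n = refl
    split false true  m n = +-suc m n
    split true  false m n = refl
    split true  true  m n = cong suc (+-suc m n)

open BooleanCounting

module SubsetFacts where

  open import Data.Nat using (ℕ; zero; suc; _+_)
  open import Data.Nat.Properties using (suc-injective; +-suc; +-comm; <-irrefl; ≤-trans; ≤-reflexive)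
  open import Data.Fin using (Fin; zero; suc)
  open import Data.Fin.Properties using () renaming (suc-injective to Fin-suc-injective)
  open import Data.Fin.Subset using (Subset; ⁅_⁆; _∪_; _∩_; ∁; ∣_∣; _⊆_; _∈_; _∉_; _-_; ⊥)
  open import Data.Fin.Subset.Properties using (∪-identityˡ; ∪-identityʳ; p─⊥≡p; ∣p∩q∣≤∣p∣)
  open import Data.Bool.Properties using (∨-identityʳ)
  open import Data.List using (map)
  open import Data.List.Membership.Propositional using () renaming (_∈_ to _∈ₗ_)
  open import Data.List.Membership.Propositional.Properties using (∈-++⁺ˡ; ∈-++⁺ʳ; ∈-map⁺)
  open import Data.List.Relation.Unary.Any using (here)
  open import Data.Vec using ([]; _∷_; here; there)

  private variable
    n : ℕ

  ∈-allSubsets : ∀ (S : Subset n) → S ∈ₗ allSubsets n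
  ∈-allSubsets []          = here refl
  ∈-allSubsets (true ∷ S)  = ∈-++⁺ˡ (∈-map⁺ (true ∷_) (∈-allSubsets S))
  ∈-allSubsets {suc n} (false ∷ S) =
    ∈-++⁺ʳ (map (true ∷_) (allSubsets n)) (∈-map⁺ (false ∷_) (∈-allSubsets S))

  #sub-∷ : ∀ (p : Subset (suc n) → Bool) → #sub p ≡ #sub (λ S → p (true ∷ S)) + #sub (λ S → p (false ∷ S))
  #sub-∷ {n} p
    rewrite count-++ p (map (true ∷_) (allSubsets n)) (map (false ∷_) (allSubsets n))
          | count-map p (true ∷_) (allSubsets n) | count-map p (false ∷_) (allSubsets n) = refl

  ∣p∣≡0⇒p≡⊥ : ∀ (S : Subset n) → ∣ S ∣ ≡ 0 → S ≡ ⊥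
  ∣p∣≡0⇒p≡⊥ []          _ = refl
  ∣p∣≡0⇒p≡⊥ (false ∷ S) h = cong (false ∷_) (∣p∣≡0⇒p≡⊥ S h)

  ∣p∣≡1⇒singleton : ∀ (S : Subset n) → ∣ S ∣ ≡ 1 → ∃ λ a → S ≡ ⁅ a ⁆
  ∣p∣≡1⇒singleton (true ∷ S)  h = zero , cong (true ∷_) (∣p∣≡0⇒p≡⊥ S (suc-injective h))
  ∣p∣≡1⇒singleton (false ∷ S) h with ∣p∣≡1⇒singleton S h
  ... | a , refl = suc a , refl

  ∣p∣≡2⇒pair : ∀ (S : Subset n) → ∣ S ∣ ≡ 2 → ∃₂ λ a b → a ≢ b × S ≡ ⁅ a ⁆ ∪ ⁅ b ⁆
  ∣p∣≡2⇒pair (true ∷ S) h with ∣p∣≡1⇒singleton S (suc-injective h)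
  ... | b , refl = zero , suc b , (λ ()) , cong (true ∷_) (sym (∪-identityˡ ⁅ b ⁆))
  ∣p∣≡2⇒pair (false ∷ S) h with ∣p∣≡2⇒pair S h
  ... | a , b , a≢b , refl = suc a , suc b , (λ sa≡sb → a≢b (Fin-suc-injective sa≡sb)) , refl

  ∣p∩q∣≡∣p∣⇒p⊆q : ∀ (S A : Subset n) → ∣ S ∩ A ∣ ≡ ∣ S ∣ → S ⊆ A
  ∣p∩q∣≡∣p∣⇒p⊆q (true ∷ S)  (true ∷ A)  h here      = here
  ∣p∩q∣≡∣p∣⇒p⊆q (true ∷ S)  (true ∷ A)  h (there i) =
    there (∣p∩q∣≡∣p∣⇒p⊆q S A (suc-injective h) i)
  ∣p∩q∣≡∣p∣⇒p⊆q (true ∷ S)  (false ∷ A) h _         =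
    ⊥-elim (<-irrefl refl (≤-trans (≤-reflexive (sym h)) (∣p∩q∣≤∣p∣ S A)))
  ∣p∩q∣≡∣p∣⇒p⊆q (false ∷ S) (_ ∷ A)     h (there i) = there (∣p∩q∣≡∣p∣⇒p⊆q S A h i)

  ∣p∩q∣+∣p∩∁q∣≡∣p∣ : ∀ (S A : Subset n) → ∣ S ∩ A ∣ + ∣ S ∩ ∁ A ∣ ≡ ∣ S ∣
  ∣p∩q∣+∣p∩∁q∣≡∣p∣ []          []          = refl
  ∣p∩q∣+∣p∩∁q∣≡∣p∣ (true ∷ S)  (true ∷ A)  = cong suc (∣p∩q∣+∣p∩∁q∣≡∣p∣ S A)
  ∣p∩q∣+∣p∩∁q∣≡∣p∣ (true ∷ S)  (false ∷ A) = trans (+-suc _ _) (cong suc (∣p∩q∣+∣p∩∁q∣≡∣p∣ S A))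
  ∣p∩q∣+∣p∩∁q∣≡∣p∣ (false ∷ S) (_ ∷ A)     = ∣p∩q∣+∣p∩∁q∣≡∣p∣ S A

  x∈p⇒p∪⁅x⁆≡p : ∀ {x : Fin n} {S} → x ∈ S → S ∪ ⁅ x ⁆ ≡ S
  x∈p⇒p∪⁅x⁆≡p {S = true ∷ S} here      = cong (true ∷_) (∪-identityʳ S)
  x∈p⇒p∪⁅x⁆≡p {S = b ∷ S}    (there i) = cong₂ _∷_ (∨-identityʳ b) (x∈p⇒p∪⁅x⁆≡p i)

  toggle : Fin n → Subset n → Subset n
  toggle zero    (b ∷ S) = not b ∷ S
  toggle (suc i) (b ∷ S) = b ∷ toggle i S

  toggle-involutive : ∀ (i : Fin n) S → toggle i (toggle i S) ≡ S
  toggle-involutive zero    (true ∷ S)  = refl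
  toggle-involutive zero    (false ∷ S) = refl
  toggle-involutive (suc i) (b ∷ S)     = cong (b ∷_) (toggle-involutive i S)

  ∉⇒∈-toggle : ∀ (i : Fin n) S → i ∉ S → i ∈ toggle i S
  ∉⇒∈-toggle zero    (true ∷ S)  i∉S = ⊥-elim (i∉S here)
  ∉⇒∈-toggle zero    (false ∷ S) i∉S = here
  ∉⇒∈-toggle (suc i) (b ∷ S)     i∉S = there (∉⇒∈-toggle i S (λ i∈S → i∉S (there i∈S)))

  ∈⇒∉-toggle : ∀ (i : Fin n) S → i ∈ S → i ∉ toggle i S
  ∈⇒∉-toggle zero    (true ∷ S) here      ()
  ∈⇒∉-toggle (suc i) (b ∷ S)    (there p) (there q) = ∈⇒∉-toggle i S p q

  toggle-∉ : ∀ (i : Fin n) S → i ∉ S → toggle i S ≡ S ∪ ⁅ i ⁆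
  toggle-∉ zero    (true ∷ S)  i∉S = ⊥-elim (i∉S here)
  toggle-∉ zero    (false ∷ S) i∉S = cong (true ∷_) (sym (∪-identityʳ S))
  toggle-∉ (suc i) (b ∷ S)     i∉S =
    cong₂ _∷_ (sym (∨-identityʳ b)) (toggle-∉ i S (λ i∈S → i∉S (there i∈S)))

  toggle-∈ : ∀ (i : Fin n) S → i ∈ S → S - i ≡ toggle i S
  toggle-∈ zero    (true ∷ S) here      = cong (false ∷_) (p─⊥≡p S)
  toggle-∈ (suc i) (b ∷ S)    (there p) = cong (b ∷_) (toggle-∈ i S p)

  ∣toggle∣-∉ : ∀ (i : Fin n) S → i ∉ S → ∣ toggle i S ∣ ≡ suc ∣ S ∣
  ∣toggle∣-∉ zero    (true ∷ S)  i∉S = ⊥-elim (i∉S here)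
  ∣toggle∣-∉ zero    (false ∷ S) i∉S = refl
  ∣toggle∣-∉ (suc i) (true ∷ S)  i∉S = cong suc (∣toggle∣-∉ i S (λ i∈S → i∉S (there i∈S)))
  ∣toggle∣-∉ (suc i) (false ∷ S) i∉S = ∣toggle∣-∉ i S (λ i∈S → i∉S (there i∈S))

  ∣toggle∣-∈ : ∀ (i : Fin n) S → i ∈ S → ∣ S ∣ ≡ suc ∣ toggle i S ∣
  ∣toggle∣-∈ i S i∈S = trans (cong ∣_∣ (sym (toggle-involutive i S)))
                            (∣toggle∣-∉ i (toggle i S) (∈⇒∉-toggle i S i∈S))

  ∩-toggle : ∀ (i : Fin n) E A → i ∉ E → E ∩ toggle i A ≡ E ∩ A
  ∩-toggle zero    (true ∷ E)  (a ∷ A) i∉E = ⊥-elim (i∉E here)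
  ∩-toggle zero    (false ∷ E) (a ∷ A) i∉E = refl
  ∩-toggle (suc i) (b ∷ E)     (a ∷ A) i∉E = cong ((b ∧ a) ∷_) (∩-toggle i E A (λ i∈E → i∉E (there i∈E)))

  ∣∩∣-toggle-∈ : ∀ (i : Fin n) E A → i ∈ E → i ∈ A → ∣ E ∩ A ∣ ≡ suc ∣ toggle i E ∩ A ∣
  ∣∩∣-toggle-∈ zero    (true ∷ E)  (true ∷ A)  here       here       = refl
  ∣∩∣-toggle-∈ (suc i) (true ∷ E)  (true ∷ A)  (there p)  (there q)  = cong suc (∣∩∣-toggle-∈ i E A p q)
  ∣∩∣-toggle-∈ (suc i) (true ∷ E)  (false ∷ A) (there p)  (there q)  = ∣∩∣-toggle-∈ i E A p q
  ∣∩∣-toggle-∈ (suc i) (false ∷ E) (_ ∷ A)     (there p)  (there q)  = ∣∩∣-toggle-∈ i E A p q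

  ∣∩∣-toggle-∉ : ∀ (i : Fin n) E A → i ∈ E → i ∉ A → ∣ E ∩ A ∣ ≡ ∣ toggle i E ∩ A ∣
  ∣∩∣-toggle-∉ zero    (true ∷ E)  (true ∷ A)  here      i∉A = ⊥-elim (i∉A here)
  ∣∩∣-toggle-∉ zero    (true ∷ E)  (false ∷ A) here      i∉A = refl
  ∣∩∣-toggle-∉ (suc i) (true ∷ E)  (true ∷ A)  (there p) i∉A =
    cong suc (∣∩∣-toggle-∉ i E A p (λ i∈A → i∉A (there i∈A)))
  ∣∩∣-toggle-∉ (suc i) (true ∷ E)  (false ∷ A) (there p) i∉A =
    ∣∩∣-toggle-∉ i E A p (λ i∈A → i∉A (there i∈A))
  ∣∩∣-toggle-∉ (suc i) (false ∷ E) (_ ∷ A)     (there p) i∉A =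
    ∣∩∣-toggle-∉ i E A p (λ i∈A → i∉A (there i∈A))

  #sub-toggle : ∀ (i : Fin n) (p : Subset n → Bool) → #sub (λ S → p (toggle i S)) ≡ #sub p
  #sub-toggle {suc n} zero p
    rewrite #sub-∷ (λ S → p (toggle zero S)) | #sub-∷ p = +-comm (#sub (λ S → p (false ∷ S))) _
  #sub-toggle {suc n} (suc i) p
    rewrite #sub-∷ (λ S → p (toggle (suc i) S)) | #sub-∷ p
          | #sub-toggle i (λ S → p (true ∷ S)) | #sub-toggle i (λ S → p (false ∷ S)) = refl

open SubsetFacts

module Matchings where

  open import Data.Nat using (ℕ; zero; suc; _+_; _∸_; _*_; _≤_; _<_; z≤n; s≤s)
  open import Data.Nat.Properties
    using (≤-refl; ≤-trans; ≤-reflexive; ≤-pred; +-mono-≤; +-comm; +-identityʳ; *-monoˡ-≤)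
  open import Data.Fin using (Fin; zero; suc)
  open import Data.Fin.Subset using (Subset; Nonempty; ⁅_⁆; _∪_; _∩_; ∣_∣; _∈_)
  open import Data.Fin.Subset.Properties
    using ( _∈?_; drop-there; nonempty?; Empty-unique; ∉⊥; ∣⊥∣≡0; ∩-comm; ∩-idem
          ; x∈p∩q⁻; x∈p∪q⁻; x∈⁅y⁆⇒x≡y)
  open import Data.Bool.Properties using (∧-identityʳ; ∧-zeroʳ; ∨-zeroʳ) renaming (_≟_ to _≟ᵇ_)
  open import Data.Vec using (_∷_; there)
  open import Data.Vec.Properties using (≡-dec)
  open import Relation.Nullary using (yes; no)
  open import Relation.Nullary.Decidable using (⌊_⌋; ⌊⌋-map′)

  private variable
    n : ℕ

  #sub-size≡0 : #sub {n} (λ T → ∣ T ∣ =ᵇ 0) ≤ 1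
  #sub-size≡0 {zero}  = ≤-refl
  #sub-size≡0 {suc n} rewrite #sub-∷ {n} (λ T → ∣ T ∣ =ᵇ 0) | count-false (allSubsets n) = #sub-size≡0 {n}

  #sub-size≡1 : #sub {n} (λ T → ∣ T ∣ =ᵇ 1) ≤ n
  #sub-size≡1 {zero}  = z≤n
  #sub-size≡1 {suc n} rewrite #sub-∷ {n} (λ T → ∣ T ∣ =ᵇ 1) = +-mono-≤ (#sub-size≡0 {n}) (#sub-size≡1 {n})

  #sub-size-∋-zero : ∀ k →
    #sub {suc n} (λ T → (∣ T ∣ =ᵇ suc k) ∧ ⌊ zero ∈? T ⌋) ≡ #sub {n} (λ T → ∣ T ∣ =ᵇ k)
  #sub-size-∋-zero {n} k =
    trans (#sub-∷ {n} (λ T → (∣ T ∣ =ᵇ suc k) ∧ ⌊ zero ∈? T ⌋))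
      (trans (cong₂ _+_ (count-cong (λ T → ∧-identityʳ (∣ T ∣ =ᵇ k)) (allSubsets n))
                        (trans (count-cong (λ T → ∧-zeroʳ (∣ T ∣ =ᵇ suc k)) (allSubsets n))
                               (count-false (allSubsets n))))
             (+-identityʳ _))

  #sub-size-∋-suc : ∀ k (a : Fin n) →
    #sub (λ T → (∣ T ∣ =ᵇ suc k) ∧ ⌊ suc a ∈? T ⌋) ≡
    #sub (λ T → (∣ T ∣ =ᵇ k) ∧ ⌊ a ∈? T ⌋) + #sub (λ T → (∣ T ∣ =ᵇ suc k) ∧ ⌊ a ∈? T ⌋)
  #sub-size-∋-suc {n} k a =
    trans (#sub-∷ (λ T → (∣ T ∣ =ᵇ suc k) ∧ ⌊ suc a ∈? T ⌋)) (cong₂ _+_ drop-suc drop-suc)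
    where
    drop-suc : ∀ {b} → count (λ T → (∣ b ∷ T ∣ =ᵇ suc k) ∧ ⌊ suc a ∈? (b ∷ T) ⌋) (allSubsets n) ≡
                       count (λ T → (∣ b ∷ T ∣ =ᵇ suc k) ∧ ⌊ a ∈? T ⌋) (allSubsets n)
    drop-suc {b} =
      count-cong (λ T → cong ((∣ b ∷ T ∣ =ᵇ suc k) ∧_) (⌊⌋-map′ there drop-there (a ∈? T))) (allSubsets n)

  #sub-size≡1-∋ : ∀ (a : Fin n) → #sub (λ T → (∣ T ∣ =ᵇ 1) ∧ ⌊ a ∈? T ⌋) ≤ 1
  #sub-size≡1-∋ {suc n} zero    rewrite #sub-size-∋-zero {n} 0 = #sub-size≡0 {n}
  #sub-size≡1-∋ {suc n} (suc a) rewrite #sub-size-∋-suc 0 a =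
    +-mono-≤ (≤-reflexive (count-none empty∌a (allSubsets n))) (#sub-size≡1-∋ a)
    where
    empty∌a : ∀ T → (∣ T ∣ =ᵇ 0) ∧ ⌊ a ∈? T ⌋ ≡ true → Empty
    empty∌a T h with ∧-true⁻ {∣ T ∣ =ᵇ 0} h
    ... | ∣T∣≡0 , a∈T = ∉⊥ (subst (a ∈_) (∣p∣≡0⇒p≡⊥ T (=ᵇ⇒≡ ∣T∣≡0)) (⌊⌋⇒ (a ∈? T) a∈T))

  #sub-size≡2-∋ : ∀ (a : Fin n) → #sub (λ T → (∣ T ∣ =ᵇ 2) ∧ ⌊ a ∈? T ⌋) ≤ n ∸ 1
  #sub-size≡2-∋ {suc n}       zero    rewrite #sub-size-∋-zero {n} 1 = #sub-size≡1 {n}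
  #sub-size≡2-∋ {suc (suc n)} (suc a) rewrite #sub-size-∋-suc 1 a =
    +-mono-≤ (#sub-size≡1-∋ a) (#sub-size≡2-∋ a)

  meets : Subset n → Subset n → Bool
  meets S T = (∣ T ∣ =ᵇ 2) ∧ not (∣ S ∩ T ∣ =ᵇ 0)

  ∣p∣≢0⇒nonempty : ∀ (U : Subset n) → ∣ U ∣ ≢ 0 → Nonempty U
  ∣p∣≢0⇒nonempty {n} U ∣U∣≢0 with nonempty? U
  ... | yes ne    = ne
  ... | no  empty = ⊥-elim (∣U∣≢0 (trans (cong ∣_∣ (Empty-unique empty)) (∣⊥∣≡0 n)))

  #meets-pair : ∀ (a b : Fin n) → #sub (meets (⁅ a ⁆ ∪ ⁅ b ⁆)) ≤ (n ∸ 1) + (n ∸ 1)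
  #meets-pair {n} a b =
    ≤-trans (count-mono meets⇒∋a∨∋b (allSubsets n))
      (≤-trans (count-∨ (pair∋ a) (pair∋ b) (allSubsets n)) (+-mono-≤ (#sub-size≡2-∋ a) (#sub-size≡2-∋ b)))
    where
    pair∋ : Fin n → Subset n → Bool
    pair∋ c T = (∣ T ∣ =ᵇ 2) ∧ ⌊ c ∈? T ⌋
    meets⇒∋a∨∋b : ∀ T → meets (⁅ a ⁆ ∪ ⁅ b ⁆) T ≡ true → pair∋ a T ∨ pair∋ b T ≡ true
    meets⇒∋a∨∋b T h with ∧-true⁻ {∣ T ∣ =ᵇ 2} h
    ... | ∣T∣≡2 , meet with ∣p∣≢0⇒nonempty ((⁅ a ⁆ ∪ ⁅ b ⁆) ∩ T) (λ e → not-both (≡⇒=ᵇ e) meet)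
    ... | c , c∈S∩T with x∈p∩q⁻ (⁅ a ⁆ ∪ ⁅ b ⁆) T c∈S∩T
    ... | c∈S , c∈T with x∈p∪q⁻ ⁅ a ⁆ ⁅ b ⁆ c∈S
    ... | inj₁ c∈⁅a⁆ rewrite ∣T∣≡2 | x∈⁅y⁆⇒x≡y a c∈⁅a⁆ | ⌊⌋-true (a ∈? T) c∈T = refl
    ... | inj₂ c∈⁅b⁆ rewrite ∣T∣≡2 | x∈⁅y⁆⇒x≡y b c∈⁅b⁆ | ⌊⌋-true (b ∈? T) c∈T = ∨-zeroʳ (⌊ a ∈? T ⌋)

  #meets≤ : ∀ (S : Subset n) → ∣ S ∣ ≡ 2 → #sub (meets S) ≤ (n ∸ 1) + (n ∸ 1)
  #meets≤ S ∣S∣≡2 with ∣p∣≡2⇒pair S ∣S∣≡2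
  ... | a , b , _ , refl = #meets-pair a b

  record LargeMatching (G : Graph n) : Set where
    field
      M        : Graph n
      matching : Matching M
      M⊆G      : ∀ S → isGEdge M S ≡ true → isGEdge G S ≡ true
      #G≤      : #G G ≤ #G M * ((n ∸ 1) + (n ∸ 1))

  emptyMatching : ∀ (G : Graph n) → #G G ≡ 0 → LargeMatching G
  emptyMatching G #G≡0 = record
    { M        = λ _ → false
    ; matching = λ S _ S∈M _ _ → ⊥-elim (no-edge S S∈M)
    ; M⊆G      = λ S S∈M → ⊥-elim (no-edge S S∈M)
    ; #G≤      = subst (_≤ _) (sym #G≡0) z≤n
    }
    where
    no-edge : ∀ S → isGEdge (λ _ → false) S ≡ true → Empty
    no-edge S h with ∧-true⁻ {∣ S ∣ =ᵇ 2} h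
    ... | _ , ()

  avoiding : Graph n → Subset n → Graph n
  avoiding G S T = G T ∧ (∣ S ∩ T ∣ =ᵇ 0)

  withEdge : Graph n → Subset n → Graph n
  withEdge M S T = M T ∨ ⌊ ≡-dec _≟ᵇ_ T S ⌋

  avoiding⊆ : ∀ (G : Graph n) S T → isGEdge (avoiding G S) T ≡ true → isGEdge G T ≡ true
  avoiding⊆ G S T h with ∣ T ∣ =ᵇ 2 | G T | ∣ S ∩ T ∣ =ᵇ 0
  ... | true | true | true = refl

  avoiding-disjoint : ∀ (G : Graph n) S T → isGEdge (avoiding G S) T ≡ true → ∣ S ∩ T ∣ ≡ 0
  avoiding-disjoint G S T h = =ᵇ⇒≡ (proj₂ (∧-true⁻ {G T} (proj₂ (∧-true⁻ {∣ T ∣ =ᵇ 2} h))))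

  ∉avoiding : ∀ (G : Graph n) S → ∣ S ∣ ≡ 2 → isGEdge (avoiding G S) S ≡ false
  ∉avoiding G S ∣S∣≡2 rewrite ∩-idem S | ∣S∣≡2 = ∧-zeroʳ (G S)

  #G-avoiding< : ∀ (G : Graph n) S → isGEdge G S ≡ true → #G (avoiding G S) < #G G
  #G-avoiding< {n} G S S∈G =
    count-mono-< (avoiding⊆ G S) (allSubsets n) (∈-allSubsets S)
      (∉avoiding G S (=ᵇ⇒≡ (proj₁ (∧-true⁻ S∈G)))) S∈G

  #G≤avoiding+meets : ∀ (G : Graph n) S → #G G ≤ #G (avoiding G S) + #sub (meets S)
  #G≤avoiding+meets {n} G S =
    ≤-trans (count-mono avoids-or-meets (allSubsets n)) (count-∨ (isGEdge (avoiding G S)) (meets S) (allSubsets n))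
    where
    avoids-or-meets : ∀ T → isGEdge G T ≡ true → isGEdge (avoiding G S) T ∨ meets S T ≡ true
    avoids-or-meets T h with ∣ T ∣ =ᵇ 2 | G T | ∣ S ∩ T ∣ =ᵇ 0
    ... | true | true | true  = refl
    ... | true | true | false = refl

  withEdge-edge : ∀ (M : Graph n) S T → isGEdge (withEdge M S) T ≡ true → isGEdge M T ≡ true ⊎ T ≡ S
  withEdge-edge M S T h with ∣ T ∣ =ᵇ 2 | M T | ≡-dec _≟ᵇ_ T S
  ... | true | true  | _         = inj₁ refl
  ... | true | false | yes T≡S   = inj₂ T≡S

  ⊆withEdge : ∀ (M : Graph n) S T → isGEdge M T ≡ true → isGEdge (withEdge M S) T ≡ true
  ⊆withEdge M S T h with ∣ T ∣ =ᵇ 2 | M T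
  ... | true | true = refl

  ∈withEdge : ∀ (M : Graph n) S → ∣ S ∣ ≡ 2 → isGEdge (withEdge M S) S ≡ true
  ∈withEdge M S ∣S∣≡2 rewrite ∣S∣≡2 | ⌊⌋-true (≡-dec _≟ᵇ_ S S) refl = ∨-zeroʳ (M S)

  extendMatching : ∀ (G : Graph n) S → isGEdge G S ≡ true →
                   LargeMatching (avoiding G S) → LargeMatching G
  extendMatching {n} G S S∈G small = record
    { M        = withEdge M S
    ; matching = matching′
    ; M⊆G      = M⊆G′
    ; #G≤      = ≤-trans (#G≤avoiding+meets G S)
                   (≤-trans (+-mono-≤ #G≤ (#meets≤ S ∣S∣≡2))
                     (≤-trans (≤-reflexive (+-comm (#G M * d) d)) (*-monoˡ-≤ d grows)))
    }
    where
    open LargeMatching small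
    d = (n ∸ 1) + (n ∸ 1)
    ∣S∣≡2 : ∣ S ∣ ≡ 2
    ∣S∣≡2 = =ᵇ⇒≡ (proj₁ (∧-true⁻ S∈G))
    M-disjoint : ∀ T → isGEdge M T ≡ true → ∣ S ∩ T ∣ ≡ 0
    M-disjoint T T∈M = avoiding-disjoint G S T (M⊆G T T∈M)
    matching′ : Matching (withEdge M S)
    matching′ T U T∈ U∈ T≢U with withEdge-edge M S T T∈ | withEdge-edge M S U U∈
    ... | inj₁ T∈M  | inj₁ U∈M  = matching T U T∈M U∈M T≢U
    ... | inj₂ refl | inj₁ U∈M  = M-disjoint U U∈M
    ... | inj₁ T∈M  | inj₂ refl = trans (cong ∣_∣ (∩-comm T S)) (M-disjoint T T∈M)
    ... | inj₂ refl | inj₂ refl = ⊥-elim (T≢U refl)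
    M⊆G′ : ∀ T → isGEdge (withEdge M S) T ≡ true → isGEdge G T ≡ true
    M⊆G′ T T∈ with withEdge-edge M S T T∈
    ... | inj₁ T∈M  = avoiding⊆ G S T (M⊆G T T∈M)
    ... | inj₂ refl = S∈G
    S∉M : isGEdge M S ≡ false
    S∉M with isGEdge M S in S∈M
    ... | false = refl
    ... | true  = trans (sym (M⊆G S S∈M)) (∉avoiding G S ∣S∣≡2)
    grows : suc (#G M) ≤ #G (withEdge M S)
    grows = count-mono-< (⊆withEdge M S) (allSubsets n) (∈-allSubsets S) S∉M (∈withEdge M S ∣S∣≡2)

  greedyMatching : ∀ k (G : Graph n) → #G G ≤ k → LargeMatching G
  greedyMatching {n} k G #G≤k with #G G in #G≡ | k
  ... | zero  | _     = emptyMatching G #G≡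
  ... | suc _ | suc k with S , S∈G ← count-witness (isGEdge G) (allSubsets n) (subst (0 <_) (sym #G≡) (s≤s z≤n)) =
    extendMatching G S S∈G (greedyMatching k (avoiding G S) #avoiding≤k)
    where
    #avoiding≤k : #G (avoiding G S) ≤ k
    #avoiding≤k = ≤-pred (≤-trans (#G-avoiding< G S S∈G) (subst (_≤ suc k) (sym #G≡) #G≤k))

  largeMatching : ∀ (G : Graph n) → LargeMatching G
  largeMatching G = greedyMatching (#G G) G ≤-refl

open Matchings

module Links where

  open import Data.Nat using (ℕ)
  open import Data.Fin using (Fin)
  open import Data.Fin.Subset using (Subset; ⁅_⁆; _∪_; ∣_∣; _∈_; _∉_; _-_)
  open import Data.Fin.Subset.Properties using (_∈?_; ∪-assoc; x∈⁅x⁆; x∈p∪q⁺)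
  open import Data.Bool.Properties using (∧-zeroʳ)
  open import Relation.Nullary using (yes; no)
  open import Relation.Nullary.Decidable using (⌊_⌋)

  private variable
    n : ℕ

  link : 3Graph n → Fin n → (Subset n → Bool) → Graph n
  link H v φ S = not (⌊ v ∈? S ⌋) ∧ (φ S ∧ isEdge H (S ∪ ⁅ v ⁆))

  #G-link : ∀ (H : 3Graph n) v φ → #G (link H v φ) ≡ #edges H (λ E → ⌊ v ∈? E ⌋ ∧ φ (E - v))
  #G-link {n} H v φ =
    trans (count-cong same (allSubsets n)) (#sub-toggle v (λ E → isEdge H E ∧ (⌊ v ∈? E ⌋ ∧ φ (E - v))))
    where
    rearrange : ∀ a f h → a ∧ (true ∧ (f ∧ (a ∧ h))) ≡ (a ∧ h) ∧ (true ∧ f)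
    rearrange false f     h     = refl
    rearrange true  false h     = sym (∧-zeroʳ h)
    rearrange true  true  false = refl
    rearrange true  true  true  = refl
    same : ∀ S → isGEdge (link H v φ) S ≡ isEdge H (toggle v S) ∧ (⌊ v ∈? toggle v S ⌋ ∧ φ (toggle v S - v))
    same S with v ∈? S
    ... | yes v∈S rewrite ⌊⌋-false (v ∈? toggle v S) (∈⇒∉-toggle v S v∈S) =
      trans (∧-zeroʳ (∣ S ∣ =ᵇ 2)) (sym (∧-zeroʳ (isEdge H (toggle v S))))
    ... | no v∉S
      rewrite toggle-∈ v (toggle v S) (∉⇒∈-toggle v S v∉S) | toggle-involutive v S
            | ⌊⌋-true (v ∈? toggle v S) (∉⇒∈-toggle v S v∉S)
            | sym (toggle-∉ v S v∉S) | ∣toggle∣-∉ v S v∉S =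
      rearrange (∣ S ∣ =ᵇ 2) (φ S) (H (toggle v S))

  record LinkPair (H : 3Graph n) (v : Fin n) (φ : Subset n → Bool) (S : Subset n) : Set where
    field
      size  : ∣ S ∣ ≡ 2
      holds : φ S ≡ true
      edge  : isEdge H (S ∪ ⁅ v ⁆) ≡ true

  linkPair : ∀ (H : 3Graph n) v φ S → isGEdge (link H v φ) S ≡ true → LinkPair H v φ S
  linkPair H v φ S S∈link with ∧-true⁻ {∣ S ∣ =ᵇ 2} S∈link
  ... | ∣S∣≡2 , rest with ∧-true⁻ {φ S} (proj₂ (∧-true⁻ {not ⌊ v ∈? S ⌋} rest))
  ...   | φS , edge = record { size = =ᵇ⇒≡ ∣S∣≡2 ; holds = φS ; edge = edge }

  edge-∪⇒∉ : ∀ (H : 3Graph n) S u → ∣ S ∣ ≡ 2 → isEdge H (S ∪ ⁅ u ⁆) ≡ true → u ∉ S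
  edge-∪⇒∉ H S u ∣S∣≡2 edge u∈S
    with () ← trans (sym ∣S∣≡2) (trans (cong ∣_∣ (sym (x∈p⇒p∪⁅x⁆≡p u∈S))) (=ᵇ⇒≡ (proj₁ (∧-true⁻ edge))))

  no-T5-copy : ∀ (H : 3Graph n) → T5-free H → ∀ (P Q : Subset n) v → ∣ P ∣ ≡ 2 → ∣ Q ∣ ≡ 2 →
               isEdge H (P ∪ ⁅ v ⁆) ≡ true → isEdge H (Q ∪ ⁅ v ⁆) ≡ true →
               (∀ u → u ∈ Q → isEdge H (P ∪ ⁅ u ⁆) ≡ true) → Empty
  no-T5-copy H t5-free P Q v ∣P∣≡2 ∣Q∣≡2 Pv Qv PQ with ∣p∣≡2⇒pair P ∣P∣≡2 | ∣p∣≡2⇒pair Q ∣Q∣≡2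
  ... | a , b , a≢b , refl | c , d , c≢d , refl =
    t5-free a b c d v a≢b
      (∈-∉⇒≢ c∉ab a∈ab) (∈-∉⇒≢ d∉ab a∈ab) (∈-∉⇒≢ v∉ab a∈ab) (∈-∉⇒≢ c∉ab b∈ab) (∈-∉⇒≢ d∉ab b∈ab) (∈-∉⇒≢ v∉ab b∈ab)
      c≢d (∈-∉⇒≢ v∉cd c∈cd) (∈-∉⇒≢ v∉cd d∈cd)
      (triple a b c (PQ c c∈cd)) (triple a b d (PQ d d∈cd)) (triple a b v Pv) (triple c d v Qv)
    where
    triple : ∀ x y z → isEdge H ((⁅ x ⁆ ∪ ⁅ y ⁆) ∪ ⁅ z ⁆) ≡ true → Edge H ⟪ x , y , z ⟫
    triple x y z = subst (λ E → isEdge H E ≡ true) (∪-assoc ⁅ x ⁆ ⁅ y ⁆ ⁅ z ⁆)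
    ∈-∉⇒≢ : ∀ {x y} {S : Subset _} → y ∉ S → x ∈ S → x ≢ y
    ∈-∉⇒≢ y∉S x∈S refl = y∉S x∈S
    a∈ab = x∈p∪q⁺ (inj₁ (x∈⁅x⁆ a))
    b∈ab = x∈p∪q⁺ (inj₂ (x∈⁅x⁆ b))
    c∈cd = x∈p∪q⁺ (inj₁ (x∈⁅x⁆ c))
    d∈cd = x∈p∪q⁺ (inj₂ (x∈⁅x⁆ d))
    c∉ab = edge-∪⇒∉ H _ c ∣P∣≡2 (PQ c c∈cd)
    d∉ab = edge-∪⇒∉ H _ d ∣P∣≡2 (PQ d d∈cd)
    v∉ab = edge-∪⇒∉ H _ v ∣P∣≡2 Pv
    v∉cd = edge-∪⇒∉ H _ v ∣Q∣≡2 Qv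

open Links

module Switching where

  open import Data.Nat using (ℕ; suc; _+_; _≤_; z≤n; s≤s)
  open import Data.Nat.Properties using (≤-refl; ≤-trans; +-monoˡ-≤; +-cancelˡ-≤; suc-injective)
  open import Data.Fin using (Fin)
  open import Data.Fin.Subset using (Subset; _∩_; ∁; ∣_∣; _∈_; _∉_; _-_)
  open import Data.Fin.Subset.Properties using (_∈?_; x∈∁p⇒x∉p)
  open import Relation.Nullary using (yes; no)
  open import Relation.Nullary.Decidable using (⌊_⌋)

  private variable
    n : ℕ

  ∈Lsame ∈Lcross : Subset n → Fin n → Subset n → Bool
  ∈Lsame  X v E = ⌊ v ∈? E ⌋ ∧ (∣ (E - v) ∩ X ∣ =ᵇ 2)
  ∈Lcross X v E = ⌊ v ∈? E ⌋ ∧ (∣ (E - v) ∩ X ∣ =ᵇ 1) ∧ (∣ (E - v) ∩ ∁ X ∣ =ᵇ 1)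

  #edges-+-mono : ∀ (H : 3Graph n) {p q r s : Subset n → Bool} →
                  (∀ E → ∣ E ∣ ≡ 3 → 𝟙 (r E) + 𝟙 (s E) ≤ 𝟙 (p E) + 𝟙 (q E)) →
                  #edges H r + #edges H s ≤ #edges H p + #edges H q
  #edges-+-mono {n} H {p} {q} {r} {s} pointwise = count-+-mono on-edges (allSubsets n)
    where
    on-edges : ∀ E → 𝟙 (isEdge H E ∧ r E) + 𝟙 (isEdge H E ∧ s E) ≤
                     𝟙 (isEdge H E ∧ p E) + 𝟙 (isEdge H E ∧ q E)
    on-edges E with isEdge H E in E∈H
    ... | false = z≤n
    ... | true  = pointwise E (=ᵇ⇒≡ (proj₁ (∧-true⁻ E∈H)))

  ∣∩toggle∣-∈ : ∀ (v : Fin n) E X → v ∈ E → v ∈ X → ∣ E ∩ toggle v X ∣ ≡ ∣ toggle v E ∩ X ∣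
  ∣∩toggle∣-∈ v E X v∈E v∈X =
    trans (∣∩∣-toggle-∉ v E (toggle v X) v∈E (∈⇒∉-toggle v X v∈X))
          (cong ∣_∣ (∩-toggle v (toggle v E) X (∈⇒∉-toggle v E v∈E)))

  ∣∩toggle∣-∉ : ∀ (v : Fin n) E X → v ∈ E → v ∉ X → ∣ E ∩ toggle v X ∣ ≡ suc ∣ toggle v E ∩ X ∣
  ∣∩toggle∣-∉ v E X v∈E v∉X =
    trans (∣∩∣-toggle-∈ v E (toggle v X) v∈E (∉⇒∈-toggle v X v∉X))
          (cong (λ U → suc ∣ U ∣) (∩-toggle v (toggle v E) X (∈⇒∉-toggle v E v∈E)))

  -- r and s count the other two vertices of the edge in X and in ∁ X.
  moving-out-of-X : ∀ r s → r + s ≡ 2 →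
    𝟙 (not (r =ᵇ 2)) + 𝟙 (r =ᵇ 2) ≤ 𝟙 (not (suc r =ᵇ 2)) + 𝟙 ((r =ᵇ 1) ∧ (s =ᵇ 1))
  moving-out-of-X 0 _ _ = s≤s z≤n
  moving-out-of-X 1 1 _ = s≤s z≤n
  moving-out-of-X 2 _ _ = s≤s z≤n

  moving-into-X : ∀ r s →
    𝟙 (not (suc r =ᵇ 2)) + 𝟙 ((r =ᵇ 1) ∧ (s =ᵇ 1)) ≤ 𝟙 (not (r =ᵇ 2)) + 𝟙 (r =ᵇ 2)
  moving-into-X 0                 _             = s≤s z≤n
  moving-into-X 1                 0             = z≤n
  moving-into-X 1                 1             = s≤s z≤n
  moving-into-X 1                 (suc (suc _)) = z≤n
  moving-into-X 2                 _             = s≤s z≤n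
  moving-into-X (suc (suc (suc _))) _           = s≤s z≤n

  #inc-move-out : ∀ (H : 3Graph n) X x → x ∈ X →
                  #inc H (toggle x X) + #Lsame H X x ≤ #inc H X + #Lcross H X (∁ X) x
  #inc-move-out H X x x∈X = #edges-+-mono H pointwise
    where
    pointwise : ∀ E → ∣ E ∣ ≡ 3 →
      𝟙 (inconsistent (toggle x X) E) + 𝟙 (∈Lsame X x E) ≤ 𝟙 (inconsistent X E) + 𝟙 (∈Lcross X x E)
    pointwise E ∣E∣≡3 with x ∈? E
    ... | no x∉E rewrite ∩-toggle x E X x∉E = ≤-refl
    ... | yes x∈E
      rewrite toggle-∈ x E x∈E | ∣∩∣-toggle-∈ x E X x∈E x∈X | ∣∩toggle∣-∈ x E X x∈E x∈X =
      moving-out-of-X ∣ toggle x E ∩ X ∣ ∣ toggle x E ∩ ∁ X ∣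
        (trans (∣p∩q∣+∣p∩∁q∣≡∣p∣ (toggle x E) X) (suc-injective (trans (sym (∣toggle∣-∈ x E x∈E)) ∣E∣≡3)))

  #inc-move-in : ∀ (H : 3Graph n) X y → y ∉ X →
                 #inc H (toggle y X) + #Lcross H X (∁ X) y ≤ #inc H X + #Lsame H X y
  #inc-move-in H X y y∉X = #edges-+-mono H pointwise
    where
    pointwise : ∀ E → ∣ E ∣ ≡ 3 →
      𝟙 (inconsistent (toggle y X) E) + 𝟙 (∈Lcross X y E) ≤ 𝟙 (inconsistent X E) + 𝟙 (∈Lsame X y E)
    pointwise E _ with y ∈? E
    ... | no y∉E rewrite ∩-toggle y E X y∉E = ≤-refl
    ... | yes y∈E
      rewrite toggle-∈ y E y∈E | ∣∩∣-toggle-∉ y E X y∈E y∉X | ∣∩toggle∣-∉ y E X y∈E y∉X =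
      moving-into-X ∣ toggle y E ∩ X ∣ ∣ toggle y E ∩ ∁ X ∣

  optimal⇒Lsame≤Lcross : ∀ (H : 3Graph n) X → Optimal H X → ∀ x → x ∈ X →
                          #Lsame H X x ≤ #Lcross H X (∁ X) x
  optimal⇒Lsame≤Lcross H X optimal x x∈X =
    +-cancelˡ-≤ (#inc H X) _ _ (≤-trans (+-monoˡ-≤ _ (optimal (toggle x X))) (#inc-move-out H X x x∈X))

  optimal⇒Lcross≤Lsame : ∀ (H : 3Graph n) X → Optimal H X → ∀ y → y ∈ ∁ X →
                          #Lcross H X (∁ X) y ≤ #Lsame H X y
  optimal⇒Lcross≤Lsame H X optimal y y∈∁X =
    +-cancelˡ-≤ (#inc H X) _ _
      (≤-trans (+-monoˡ-≤ _ (optimal (toggle y X))) (#inc-move-in H X y (x∈∁p⇒x∉p y∈∁X)))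

open Switching

module Thresholds where

  open import Data.Nat as ℕ using (ℕ; zero; suc; _∸_; _^_; NonZero)
  import Data.Nat.Properties as ℕ
  open import Data.Nat.Tactic.RingSolver using (solve-∀)
  open import Data.Integer as ℤ using (+_)
  import Data.Integer.Properties as ℤ
  import Data.Nat.Coprimality as Coprimality
  open import Data.Rational
    using (ℚ; mkℚ; _/_; Positive; NonNegative; 0ℚ; 1ℚ; _*_; _≤_; _<_; *≤*; *<*; positive; nonNegative)
  open import Data.Rational.Properties
    using (normalize-coprime; *-assoc; *-comm; *-identityˡ; *-zeroˡ; positive⁻¹; <-irrefl; <-trans; <-≤-trans;
           *-monoˡ-<-pos; *-cancelˡ-<-nonNeg; *-cancelʳ-<-nonNeg; module ≤-Reasoning)

  ℕ→ℚ≡mkℚ : ∀ k → ℕ→ℚ k ≡ mkℚ (+ k) 0 (Coprimality.sym (Coprimality.1-coprimeTo k))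
  ℕ→ℚ≡mkℚ k = normalize-coprime (Coprimality.sym (Coprimality.1-coprimeTo k))

  ℕ→ℚ-mono-≤ : ∀ {m n} → m ℕ.≤ n → ℕ→ℚ m ≤ ℕ→ℚ n
  ℕ→ℚ-mono-≤ {m} {n} m≤n rewrite ℕ→ℚ≡mkℚ m | ℕ→ℚ≡mkℚ n =
    *≤* (subst₂ ℤ._≤_ (sym (ℤ.*-identityʳ (+ m))) (sym (ℤ.*-identityʳ (+ n))) (ℤ.+≤+ m≤n))

  ℕ→ℚ-mono-< : ∀ {m n} → m ℕ.< n → ℕ→ℚ m < ℕ→ℚ n
  ℕ→ℚ-mono-< {m} {n} m<n rewrite ℕ→ℚ≡mkℚ m | ℕ→ℚ≡mkℚ n =
    *<* (subst₂ ℤ._<_ (sym (ℤ.*-identityʳ (+ m))) (sym (ℤ.*-identityʳ (+ n))) (ℤ.+<+ m<n))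

  ℕ→ℚ-* : ∀ m n → ℕ→ℚ (m ℕ.* n) ≡ ℕ→ℚ m * ℕ→ℚ n
  ℕ→ℚ-* m n rewrite ℕ→ℚ≡mkℚ m | ℕ→ℚ≡mkℚ n = cong (_/ 1) (ℤ.pos-* m n)

  ℕ→ℚ-nonNegative : ∀ k → NonNegative (ℕ→ℚ k)
  ℕ→ℚ-nonNegative k = nonNegative (ℕ→ℚ-mono-≤ {0} {k} ℕ.z≤n)

  k*[n∸1+n∸1]<2*[n*k] : ∀ n k .{{_ : NonZero n}} .{{_ : NonZero k}} →
                        k ℕ.* ((n ∸ 1) ℕ.+ (n ∸ 1)) ℕ.< 2 ℕ.* (n ℕ.* k)
  k*[n∸1+n∸1]<2*[n*k] (suc m) k = begin-strict
    k ℕ.* (m ℕ.+ m)             <⟨ ℕ.*-monoʳ-< k (ℕ.+-mono-< (ℕ.n<1+n m) (ℕ.n<1+n m)) ⟩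
    k ℕ.* (suc m ℕ.+ suc m)     ≡⟨ double (suc m) k ⟩
    2 ℕ.* (suc m ℕ.* k)         ∎
    where
    open ℕ.≤-Reasoning
    double : ∀ n k → k ℕ.* (n ℕ.+ n) ≡ 2 ℕ.* (n ℕ.* k)
    double = solve-∀

  Heavy : ℚ → ℕ → ℕ → Set
  Heavy μ n k = ℕ→ℚ 2 * μ * ℕ→ℚ (n ^ 2) ≤ ℕ→ℚ k

  module _ (μ : ℚ) .{{_ : Positive μ}} (n : ℕ) .{{_ : NonZero n}} where

    private
      n̂ = ℕ→ℚ n

    μn² : ℚ
    μn² = μ * (n̂ * n̂)

    2μn²≡2*μn² : ℕ→ℚ 2 * μ * ℕ→ℚ (n ^ 2) ≡ ℕ→ℚ 2 * μn²
    2μn²≡2*μn² = trans (*-assoc (ℕ→ℚ 2) μ _) (cong (λ z → ℕ→ℚ 2 * (μ * z)) n̂²)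
      where
      n̂² : ℕ→ℚ (n ^ 2) ≡ n̂ * n̂
      n̂² = trans (cong (λ m → ℕ→ℚ (n ℕ.* m)) (ℕ.*-identityʳ n)) (ℕ→ℚ-* n n)

    instance
      n̂*n̂-positive : Positive (n̂ * n̂)
      n̂*n̂-positive =
        positive (subst (0ℚ <_) (ℕ→ℚ-* n n) (ℕ→ℚ-mono-< (ℕ.>-nonZero⁻¹ (n ℕ.* n) {{ℕ.m*n≢0 n n}})))

      μn²-positive : Positive μn²
      μn²-positive = positive (subst (_< μn²) (*-zeroˡ (n̂ * n̂)) (*-monoˡ-<-pos (n̂ * n̂) (positive⁻¹ μ)))

    heavy⇒μn²< : ∀ L → Heavy μ n L → μn² < ℕ→ℚ L
    heavy⇒μn²< L 2μn²≤L = begin-strict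
      μn²             ≡⟨ *-identityˡ μn² ⟨
      1ℚ * μn²        <⟨ *-monoˡ-<-pos μn² (ℕ→ℚ-mono-< {1} {2} (ℕ.s≤s (ℕ.s≤s ℕ.z≤n))) ⟩
      ℕ→ℚ 2 * μn²     ≡⟨ 2μn²≡2*μn² ⟨
      ℕ→ℚ 2 * μ * ℕ→ℚ (n ^ 2) ≤⟨ 2μn²≤L ⟩
      ℕ→ℚ L ∎
      where open ≤-Reasoning

    -- The bound 2(n − 1) rather than 2n keeps this strict although Heavy is not.
    heavy⇒μn< : ∀ L k → Heavy μ n L → L ℕ.≤ k ℕ.* ((n ∸ 1) ℕ.+ (n ∸ 1)) → μ * n̂ < ℕ→ℚ k
    heavy⇒μn< L zero 2μn²≤L L≤0 =
      ⊥-elim (<-irrefl refl (<-trans (positive⁻¹ μn²) (<-≤-trans (heavy⇒μn²< L 2μn²≤L) (ℕ→ℚ-mono-≤ L≤0))))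
    heavy⇒μn< L k@(suc _) 2μn²≤L L≤ =
      *-cancelʳ-<-nonNeg n̂ {{ℕ→ℚ-nonNegative n}}
        (*-cancelˡ-<-nonNeg (ℕ→ℚ 2) {{ℕ→ℚ-nonNegative 2}} (begin-strict
        ℕ→ℚ 2 * (μ * n̂ * n̂)         ≡⟨ cong (ℕ→ℚ 2 *_) (*-assoc μ n̂ n̂) ⟩
        ℕ→ℚ 2 * μn²                 ≡⟨ 2μn²≡2*μn² ⟨
        ℕ→ℚ 2 * μ * ℕ→ℚ (n ^ 2)     ≤⟨ 2μn²≤L ⟩
        ℕ→ℚ L                       <⟨ ℕ→ℚ-mono-< (ℕ.≤-<-trans L≤ (k*[n∸1+n∸1]<2*[n*k] n k)) ⟩
        ℕ→ℚ (2 ℕ.* (n ℕ.* k))       ≡⟨ trans (ℕ→ℚ-* 2 (n ℕ.* k))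
                                             (cong (ℕ→ℚ 2 *_) (trans (ℕ→ℚ-* n k) (*-comm n̂ _))) ⟩
        ℕ→ℚ 2 * (ℕ→ℚ k * n̂)         ∎))
      where open ≤-Reasoning

open Thresholds

module HeavyLinks where

  open import Data.Nat using (ℕ; zero; suc; _*_; _<_; z≤n; s≤s; NonZero)
  open import Data.Nat.Properties using (*-zeroʳ)
  open import Data.Fin using (Fin)
  open import Data.Fin.Properties using (nonZeroIndex)
  open import Data.Fin.Subset using (Subset; ⁅_⁆; _∪_; _∩_; ∁; ∣_∣; _∈_)
  open import Data.Fin.Subset.Properties using (_∈?_; ∪-comm)
  open import Data.List using (allFin; cartesianProduct)
  open import Data.List.Membership.Propositional.Properties using (∈-allFin)
  open import Data.List.Relation.Unary.All using (lookup)
  open import Data.List.Relation.Unary.All.Properties using (all⁺)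
  open import Data.Bool.ListAction using (all)
  open import Data.Rational as ℚ using (ℚ; Positive)
  open import Relation.Nullary.Decidable using (⌊_⌋)
  open import Function using (case_of_)

  private variable
    n : ℕ

  within : Subset n → Subset n → Bool
  within A R = ∣ R ∩ A ∣ =ᵇ 2

  across : Subset n → Subset n → Subset n → Bool
  across A B R = (∣ R ∩ A ∣ =ᵇ 1) ∧ (∣ R ∩ B ∣ =ᵇ 1)

  ⊆link-within⇒GraphIn : ∀ (H : 3Graph n) v A (G : Graph n) →
    (∀ S → isGEdge G S ≡ true → isGEdge (link H v (within A)) S ≡ true) → GraphIn G A
  ⊆link-within⇒GraphIn H v A G G⊆link S S∈G =
    ∣p∩q∣≡∣p∣⇒p⊆q S A (trans (=ᵇ⇒≡ holds) (sym size))
    where open LinkPair (linkPair H v (within A) S (G⊆link S S∈G))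

  link-across-between : ∀ (H : 3Graph n) v A B → GraphBetween (link H v (across A B)) A B
  link-across-between H v A B S S∈link = =ᵇ⇒≡ (proj₁ (∧-true⁻ holds)) , =ᵇ⇒≡ (proj₂ (∧-true⁻ holds))
    where open LinkPair (linkPair H v (across A B) S S∈link)

  m<n*o⇒0<o : ∀ n {o m} → m < n * o → 0 < o
  m<n*o⇒0<o n {zero} {m} m<n*0 with () ← subst (m <_) (*-zeroʳ n) m<n*0
  m<n*o⇒0<o n {suc _} _ = s≤s z≤n

  all-if⇒ : ∀ (Q : Subset n) (e : Fin n → Bool) →
            all (λ u → if ⌊ u ∈? Q ⌋ then e u else true) (allFin n) ≡ true → ∀ u → u ∈ Q → e u ≡ true
  all-if⇒ {n} Q e h u u∈Q
    with T⇒≡true (lookup (all⁺ (λ u → if ⌊ u ∈? Q ⌋ then e u else true) (allFin n) (≡true⇒T h)) (∈-allFin u))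
  ... | e′ rewrite ⌊⌋-true (u ∈? Q) u∈Q = e′

  pairsI-witness : ∀ (H : 3Graph n) G₁ G₂ → 0 < #pairsI H G₁ G₂ →
    ∃₂ λ P Q → isGEdge G₂ P ≡ true × isGEdge G₁ Q ≡ true × (∀ u → u ∈ Q → isEdge H (P ∪ ⁅ u ⁆) ≡ true)
  pairsI-witness {n} H G₁ G₂ 0<#
    with (P , Q) , found ← count-witness _ (cartesianProduct (allSubsets n) (allSubsets n)) 0<#
    with P∈G₂ , rest ← ∧-true⁻ found
    with Q∈G₁ , fan ← ∧-true⁻ rest
    = P , Q , P∈G₂ , Q∈G₁ , all-if⇒ Q (λ u → isEdge H (P ∪ ⁅ u ⁆)) fan

  pairsII-witness : ∀ (H : 3Graph n) G₁ G₂ → 0 < #pairsII H G₁ G₂ →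
    ∃₂ λ P Q → isGEdge G₂ P ≡ true × isGEdge G₁ Q ≡ true × (∀ a → a ∈ P → isEdge H (Q ∪ ⁅ a ⁆) ≡ true)
  pairsII-witness {n} H G₁ G₂ 0<#
    with (P , Q) , found ← count-witness _ (cartesianProduct (allSubsets n) (allSubsets n)) 0<#
    with P∈G₂ , rest ← ∧-true⁻ found
    with Q∈G₁ , fan ← ∧-true⁻ rest
    = P , Q , P∈G₂ , Q∈G₁ , λ a a∈P →
        subst (λ E → isEdge H E ≡ true) (∪-comm ⁅ a ⁆ Q) (all-if⇒ P (λ a → isEdge H (⁅ a ⁆ ∪ Q)) fan a a∈P)

  module _ (μ : ℚ) .{{_ : Positive μ}} (H : 3Graph n) (t5-free : T5-free H) (X : Subset n)
           (dense : LowerDense μ H X) where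

    heavy-Lsame-Lcross⇒⊥ : ∀ v → Heavy μ n (#Lsame H X v) → Heavy μ n (#Lcross H X (∁ X) v) → Empty
    heavy-Lsame-Lcross⇒⊥ v heavy-XX heavy-XY =
      case pairsI-witness H M G (m<n*o⇒0<o 72 (proj₁ dense M G M⊆X matching G⊆X×∁X μn<∣M∣ μn²<∣G∣)) of λ where
        (P , Q , P∈G , Q∈M , fan) →
          let open LinkPair (linkPair H v (across X (∁ X)) P P∈G) renaming (size to ∣P∣≡2; edge to Pv)
              open LinkPair (linkPair H v (within X) Q (M⊆G Q Q∈M)) renaming (size to ∣Q∣≡2; edge to Qv)
          in no-T5-copy H t5-free P Q v ∣P∣≡2 ∣Q∣≡2 Pv Qv fan
      where
      instance
        n≢0 : NonZero n
        n≢0 = nonZeroIndex v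
      G : Graph n
      G = link H v (across X (∁ X))
      open LargeMatching (largeMatching (link H v (within X)))
      M⊆X : GraphIn M X
      M⊆X = ⊆link-within⇒GraphIn H v X M M⊆G
      G⊆X×∁X : GraphBetween G X (∁ X)
      G⊆X×∁X = link-across-between H v X (∁ X)
      μn<∣M∣ : μ ℚ.* ℕ→ℚ n ℚ.< ℕ→ℚ (#G M)
      μn<∣M∣ = heavy⇒μn< μ n _ (#G M) (subst (Heavy μ n) (sym (#G-link H v (within X))) heavy-XX) #G≤
      μn²<∣G∣ : μn² μ n ℚ.< ℕ→ℚ (#G G)
      μn²<∣G∣ = heavy⇒μn²< μ n (#G G) (subst (Heavy μ n) (sym (#G-link H v (across X (∁ X)))) heavy-XY)

    heavy-Lsame-Lsame∁⇒⊥ : ∀ y → Heavy μ n (#Lsame H X y) → Heavy μ n (#Lsame H (∁ X) y) → Empty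
    heavy-Lsame-Lsame∁⇒⊥ y heavy-XX heavy-YY =
      case pairsII-witness H G M (m<n*o⇒0<o 8 (proj₁ (proj₂ dense) G M G⊆X M⊆∁X matching μn²<∣G∣ μn<∣M∣)) of λ where
        (P , Q , P∈M , Q∈G , fan) →
          let open LinkPair (linkPair H y (within (∁ X)) P (M⊆G P P∈M)) renaming (size to ∣P∣≡2; edge to Py)
              open LinkPair (linkPair H y (within X) Q Q∈G) renaming (size to ∣Q∣≡2; edge to Qy)
          in no-T5-copy H t5-free Q P y ∣Q∣≡2 ∣P∣≡2 Qy Py fan
      where
      instance
        n≢0 : NonZero n
        n≢0 = nonZeroIndex y
      G : Graph n
      G = link H y (within X)
      open LargeMatching (largeMatching (link H y (within (∁ X))))
      G⊆X : GraphIn G X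
      G⊆X = ⊆link-within⇒GraphIn H y X G (λ _ S∈G → S∈G)
      M⊆∁X : GraphIn M (∁ X)
      M⊆∁X = ⊆link-within⇒GraphIn H y (∁ X) M M⊆G
      μn²<∣G∣ : μn² μ n ℚ.< ℕ→ℚ (#G G)
      μn²<∣G∣ = heavy⇒μn²< μ n (#G G) (subst (Heavy μ n) (sym (#G-link H y (within X))) heavy-XX)
      μn<∣M∣ : μ ℚ.* ℕ→ℚ n ℚ.< ℕ→ℚ (#G M)
      μn<∣M∣ = heavy⇒μn< μ n _ (#G M) (subst (Heavy μ n) (sym (#G-link H y (within (∁ X)))) heavy-YY) #G≤

open HeavyLinks

open import Data.Nat using (ℕ)
open import Data.Fin using (Fin)
open import Data.Fin.Subset using (Subset; _∈_; ∁)
open import Data.Rational using (ℚ; Positive; _*_; _≤_; _<_; _⊓_)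
open import Data.Rational.Properties using (≤-trans; <⇒≤; ≮⇒≥; ≰⇒>; p≤q⊓r⇒p≤q; p≤q⊓r⇒p≤r)

lemma13 : (μ η : ℚ) → Positive μ → Positive η →
    (n : ℕ) (H : 3Graph n) → ForbLD n η μ H →
    (X : Subset n) → Optimal H X →
    ((x : Fin n) → x ∈ X → ℕ→ℚ (#Lsame H X x) ≤ ℕ→ℚ 2 * μ * ℕ→ℚ (n Data.Nat.^ 2))
    × ((y : Fin n) → y ∈ ∁ X → ℕ→ℚ (#Lcross H X (∁ X) y) ≤ ℕ→ℚ 2 * μ * ℕ→ℚ (n Data.Nat.^ 2))
    × ((y : Fin n) → y ∈ ∁ X →
         (ℕ→ℚ (#Lsame H X y) ⊓ ℕ→ℚ (#Lsame H (∁ X) y)) < ℕ→ℚ 2 * μ * ℕ→ℚ (n Data.Nat.^ 2))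
lemma13 μ η μ-positive _ n H ((t5-free , _) , lowerDense) X optimal =
  (λ x x∈X → ≮⇒≥ λ heavy →
     no-heavy-pair x (<⇒≤ heavy) (≤-trans (<⇒≤ heavy) (ℕ→ℚ-mono-≤ (optimal⇒Lsame≤Lcross H X optimal x x∈X)))) ,
  (λ y y∈∁X → ≮⇒≥ λ heavy →
     no-heavy-pair y (≤-trans (<⇒≤ heavy) (ℕ→ℚ-mono-≤ (optimal⇒Lcross≤Lsame H X optimal y y∈∁X))) (<⇒≤ heavy)) ,
  (λ y _ → ≰⇒> λ heavy →
     no-heavy-sides y (p≤q⊓r⇒p≤q _ (ℕ→ℚ (#Lsame H (∁ X) y)) heavy) (p≤q⊓r⇒p≤r (ℕ→ℚ (#Lsame H X y)) _ heavy))
  where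
  instance
    μ⁺ : Positive μ
    μ⁺ = μ-positive
  no-heavy-pair : ∀ v → Heavy μ n (#Lsame H X v) → Heavy μ n (#Lcross H X (∁ X) v) → Empty
  no-heavy-pair = heavy-Lsame-Lcross⇒⊥ μ H t5-free X (lowerDense X optimal)
  no-heavy-sides : ∀ y → Heavy μ n (#Lsame H X y) → Heavy μ n (#Lsame H (∁ X) y) → Empty
  no-heavy-sides = heavy-Lsame-Lsame∁⇒⊥ μ H t5-free X (lowerDense X optimal)
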